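{- For every integer $n\ge 1$ let $a_n$ be the smallest positive integer such that $n+a_n$ is prime, and let $S_n=\sum_{i=1}^n a_i$. Let $p_k$ denote the $k$-th prime, $d_k=p_{k+1}-p_k$, and $\pi(x)$ the number of primes $\le x$. Then for every prime $n\ge 3$, \[ S_n=\frac12\left(2p_{\pi(n)+1}-p_{\pi(n)}+\sum_{k=1}^{\pi(n)-1} d_k^2\right), \] and for every composite integer $n\ge 4$, \[ S_n=\frac12\left(p_{\pi(n)}^2+2\bigl(n+1-p_{\pi(n)}\bigr)p_{\pi(n)+1}+\sum_{k=1}^{\pi(n)-1} d_k^2-n^2-n\right). \]
   Context: $p_1=2,p_2=3,\dots$ are the primes in increasing order. -}

module Defs where

open import Data.Nat using (ℕ; zero; suc; _+_; _*_; _∸_; _!)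
open import Data.Nat.Primality using (prime?)
open import Data.List using (List; length; filter; upTo; map)
open import Data.Nat.ListAction using (sum)
open import Relation.Nullary using (yes; no)

-- firstPrimeFrom m b : the least prime in [m, m + b], or m + b if there is none
-- (bounded linear search; the bound is always large enough where it is used).
firstPrimeFrom : ℕ → ℕ → ℕ
firstPrimeFrom m zero = m
firstPrimeFrom m (suc b) with prime? m
... | yes _ = m
... | no _  = firstPrimeFrom (suc m) b

-- nextPrime m : the smallest prime strictly greater than m.
-- Search in [m+1, m! + 1]; a prime factor of m! + 1 exceeds m, so the search
-- never runs out (Euclid).
nextPrime : ℕ → ℕ
nextPrime m = firstPrimeFrom (suc m) (m !)

a : ℕ → ℕ
a n = nextPrime n ∸ n

S : ℕ → ℕ
S n = sum (map (λ i → a (suc i)) (upTo n))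

-- p k : the k-th prime, 1-indexed (p 1 = 2, p 2 = 3, ...); p 0 = 2 is junk.
p : ℕ → ℕ
p zero = 2
p (suc zero) = 2
p (suc (suc k)) = nextPrime (p (suc k))

d : ℕ → ℕ
d k = p (suc k) ∸ p k

π : ℕ → ℕ
π x = length (filter prime? (upTo (suc x)))

sumSqGaps : ℕ → ℕ
sumSqGaps m = sum (map (λ i → d (suc i) * d (suc i)) (upTo m))

-- Let a n = nextPrime n ∸ n and S n = a 1 + ... + a n.  For n ≥ 2 write
-- k = π n, so that p k ≤ n < p (k + 1).  We prove, by induction on n ≥ 2,
--
--   2 S n = p k² + 2 (n + 1 − p k) p (k+1) + Σ_{i=1}^{k-1} d i² − n² − n        (★)
--
-- which is the composite-case formula; it holds for every n ≥ 2.  When n is prime, p k = n and (★)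
-- collapses to the prime-case formula.

module Submission where

open import Defs

module PrimeBrackets where
  open import Data.Nat
  open import Data.Nat.Properties
  open import Data.Nat.Divisibility
  open import Data.Nat.Primality
  open import Data.Nat.Primality.Factorisation using (PrimeFactorisation; factorise)
  open import Data.Product using (∃-syntax; _×_; _,_)
  open import Data.Sum using (inj₁; inj₂)
  open import Data.List using ([]; _∷_; _++_; map; filter; length; upTo)
  open import Data.List.Properties using (upTo-∷ʳ; map-++; length-++; filter-++; filter-accept; filter-reject)
  open import Data.List.Relation.Unary.All using (_∷_)
  open import Data.Nat.ListAction using (sum; product)
  open import Data.Nat.ListAction.Properties using (sum-++)
  open import Relation.Nullary using (¬_; yes; no; contradiction)
  open import Relation.Binary.Definitions using (tri<; tri≈; tri>)
  open import Relation.Binary.PropositionalEquality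
  open ≡-Reasoning

  record IsLeastPrimeFrom (m r : ℕ) : Set where
    field
      isPrime      : Prime r
      lowerBound   : m ≤ r
      noPrimeBelow : ∀ k → m ≤ k → k < r → ¬ Prime k
  open IsLeastPrimeFrom public

  least-restrict : ∀ {m m' r} → IsLeastPrimeFrom m r → m ≤ m' → m' ≤ r → IsLeastPrimeFrom m' r
  least-restrict least m≤m' m'≤r = record
    { isPrime      = isPrime least
    ; lowerBound   = m'≤r
    ; noPrimeBelow = λ k m'≤k → noPrimeBelow least k (≤-trans m≤m' m'≤k)
    }

  least-self : ∀ {m} → Prime m → IsLeastPrimeFrom m m
  least-self pm = record
    { isPrime = pm ; lowerBound = ≤-refl ; noPrimeBelow = λ k m≤k k<m → contradiction m≤k (<⇒≱ k<m) }

  least-unique : ∀ {m r r'} → IsLeastPrimeFrom m r → IsLeastPrimeFrom m r' → r ≡ r'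
  least-unique {r = r} {r'} least least' with <-cmp r r'
  ... | tri≈ _ r≡r' _ = r≡r'
  ... | tri< r<r' _ _ = contradiction (isPrime least) (noPrimeBelow least' r (lowerBound least) r<r')
  ... | tri> _ _ r'<r = contradiction (isPrime least') (noPrimeBelow least r' (lowerBound least') r'<r)

  firstPrimeFrom-least : ∀ m b x → Prime x → m ≤ x → x ≤ m + b → IsLeastPrimeFrom m (firstPrimeFrom m b)
  firstPrimeFrom-least m zero x px m≤x x≤m+0 with ≤-antisym m≤x (subst (x ≤_) (+-identityʳ m) x≤m+0)
  ... | refl = least-self px
  firstPrimeFrom-least m (suc b) x px m≤x x≤m+1+b with prime? m
  ... | yes pm = least-self pm
  ... | no ¬pm = record
        { isPrime      = isPrime fromSucM
        ; lowerBound   = ≤-trans (n≤1+n m) (lowerBound fromSucM)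
        ; noPrimeBelow = below
        }
    where
    m<x : m < x
    m<x = ≤∧≢⇒< m≤x (λ m≡x → ¬pm (subst Prime (sym m≡x) px))
    fromSucM : IsLeastPrimeFrom (suc m) (firstPrimeFrom (suc m) b)
    fromSucM = firstPrimeFrom-least (suc m) b x px m<x (subst (x ≤_) (+-suc m b) x≤m+1+b)
    below : ∀ k → m ≤ k → k < firstPrimeFrom (suc m) b → ¬ Prime k
    below k m≤k k<r with m ≟ k
    ... | yes refl = ¬pm
    ... | no m≢k   = noPrimeBelow fromSucM k (≤∧≢⇒< m≤k m≢k) k<r

  primeDivisor : ∀ n → 2 ≤ n → ∃[ q ] Prime q × q ∣ n
  primeDivisor (suc zero) (s≤s ())
  primeDivisor n@(suc (suc _)) _ = fromFactorisation (factorise n)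
    where
    fromFactorisation : PrimeFactorisation n → ∃[ q ] Prime q × q ∣ n
    fromFactorisation record { factors = [] ; isFactorisation = () }
    fromFactorisation record { factors = q ∷ qs ; isFactorisation = n≡Π ; factorsPrime = pq ∷ _ } =
      q , pq , subst (q ∣_) (sym n≡Π) (m∣m*n (product qs))

  ∣-factorial : ∀ {k n} → 1 ≤ k → k ≤ n → k ∣ n !
  ∣-factorial {suc j} _ k≤n = ∣-trans (m∣m*n (j !)) (m≤n⇒m!∣n! k≤n)

  -- Euclid: a prime factor of m! + 1 lies in (m, m + 1 + m!].
  primeAbove : ∀ m → ∃[ x ] Prime x × m < x × x ≤ suc m + m !
  primeAbove m with primeDivisor (suc (m !)) (s≤s (1≤n! m))
  ... | q , pq , q∣m!+1 = q , pq , m<q , ≤-trans (∣⇒≤ q∣m!+1) (s≤s (m≤n+m (m !) m))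
    where
    m<q : m < q
    m<q with m <? q
    ... | yes m<q = m<q
    ... | no m≮q = contradiction (subst Prime (∣1⇒≡1 q∣1) pq) ¬prime[1]
      where
      1≤q : 1 ≤ q
      1≤q = <⇒≤ (nonTrivial⇒n>1 q {{prime⇒nonTrivial pq}})
      q∣1 : q ∣ 1
      q∣1 = ∣m+n∣m⇒∣n (subst (q ∣_) (+-comm 1 (m !)) q∣m!+1) (∣-factorial 1≤q (≮⇒≥ m≮q))

  nextPrime-least : ∀ m → IsLeastPrimeFrom (suc m) (nextPrime m)
  nextPrime-least m with primeAbove m
  ... | x , px , m<x , x≤bound = firstPrimeFrom-least (suc m) (m !) x px m<x x≤bound

  nextPrime-constant : ∀ {q n} → q ≤ n → n < nextPrime q → nextPrime n ≡ nextPrime q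
  nextPrime-constant {q} {n} q≤n n<next =
    least-unique (nextPrime-least n) (least-restrict (nextPrime-least q) (s≤s q≤n) n<next)

  p-prime : ∀ k → Prime (p (suc k))
  p-prime zero    = prime[2]
  p-prime (suc k) = isPrime (nextPrime-least (p (suc k)))

  sum-upTo-suc : ∀ (f : ℕ → ℕ) n → sum (map f (upTo (suc n))) ≡ sum (map f (upTo n)) + f n
  sum-upTo-suc f n = begin
    sum (map f (upTo (suc n)))                 ≡⟨ cong (λ l → sum (map f l)) (sym (upTo-∷ʳ n)) ⟩
    sum (map f (upTo n ++ n ∷ []))             ≡⟨ cong sum (map-++ f (upTo n) (n ∷ [])) ⟩
    sum (map f (upTo n) ++ f n ∷ [])           ≡⟨ sum-++ (map f (upTo n)) (f n ∷ []) ⟩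
    sum (map f (upTo n)) + (f n + 0)           ≡⟨ cong (sum (map f (upTo n)) +_) (+-identityʳ (f n)) ⟩
    sum (map f (upTo n)) + f n                 ∎

  S-suc : ∀ n → S (suc n) ≡ S n + a (suc n)
  S-suc = sum-upTo-suc (λ i → a (suc i))

  sumSqGaps-suc : ∀ m → sumSqGaps (suc m) ≡ sumSqGaps m + d (suc m) * d (suc m)
  sumSqGaps-suc = sum-upTo-suc (λ i → d (suc i) * d (suc i))

  π-suc : ∀ x → π (suc x) ≡ π x + length (filter prime? (suc x ∷ []))
  π-suc x = begin
    length (filter prime? (upTo (suc (suc x))))
      ≡⟨ cong (λ l → length (filter prime? l)) (sym (upTo-∷ʳ (suc x))) ⟩
    length (filter prime? (upTo (suc x) ++ suc x ∷ []))
      ≡⟨ cong length (filter-++ prime? (upTo (suc x)) (suc x ∷ [])) ⟩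
    length (filter prime? (upTo (suc x)) ++ filter prime? (suc x ∷ []))
      ≡⟨ length-++ (filter prime? (upTo (suc x))) ⟩
    π x + length (filter prime? (suc x ∷ [])) ∎

  π-suc-prime : ∀ x → Prime (suc x) → π (suc x) ≡ suc (π x)
  π-suc-prime x px = begin
    π (suc x)                                  ≡⟨ π-suc x ⟩
    π x + length (filter prime? (suc x ∷ []))  ≡⟨ cong (λ l → π x + length l) (filter-accept prime? px) ⟩
    π x + 1                                    ≡⟨ +-comm (π x) 1 ⟩
    suc (π x)                                  ∎

  π-suc-nonprime : ∀ x → ¬ Prime (suc x) → π (suc x) ≡ π x
  π-suc-nonprime x ¬px = begin
    π (suc x)                                  ≡⟨ π-suc x ⟩
    π x + length (filter prime? (suc x ∷ []))  ≡⟨ cong (λ l → π x + length l) (filter-reject prime? ¬px) ⟩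
    π x + 0                                    ≡⟨ +-identityʳ (π x) ⟩
    π x                                        ∎

  record Bracket (n : ℕ) : Set where
    field
      m     : ℕ
      π≡    : π n ≡ suc m
      lower : p (suc m) ≤ n
      upper : n < p (suc (suc m))
  open Bracket public

  data BracketStep (n m : ℕ) : Set where
    stay  : suc n < p (2 + m) → π (suc n) ≡ suc m → BracketStep n m
    cross : suc n ≡ p (2 + m) → π (suc n) ≡ 2 + m → BracketStep n m

  bracket-step : ∀ {n} (br : Bracket n) → BracketStep n (m br)
  bracket-step {n} br with m≤n⇒m<n∨m≡n (upper br)
  ... | inj₁ n+1<r = stay n+1<r (trans (π-suc-nonprime n n+1-nonprime) (π≡ br))
    where
    n+1-nonprime : ¬ Prime (suc n)
    n+1-nonprime = noPrimeBelow (nextPrime-least (p (suc (m br)))) (suc n) (s≤s (lower br)) n+1<r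
  ... | inj₂ n+1≡r = cross n+1≡r (trans (π-suc-prime n n+1-prime) (cong suc (π≡ br)))
    where
    n+1-prime : Prime (suc n)
    n+1-prime = subst Prime (sym n+1≡r) (p-prime (suc (m br)))

  bracket : ∀ j → Bracket (2 + j)
  bracket zero = record { m = 0 ; π≡ = refl ; lower = ≤-refl ; upper = s≤s (s≤s (s≤s z≤n)) }
  bracket (suc j) with bracket j
  ... | br with bracket-step br
  ...   | stay n+1<r π-eq = record
          { m = m br ; π≡ = π-eq ; lower = m≤n⇒m≤1+n (lower br) ; upper = n+1<r }
  ...   | cross n+1≡r π-eq = record
          { m     = suc (m br)
          ; π≡    = π-eq
          ; lower = ≤-reflexive (sym n+1≡r)
          ; upper = subst (_< p (3 + m br)) (sym n+1≡r) (lowerBound (nextPrime-least (p (2 + m br))))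
          }

  a-within : ∀ {m n} → p (suc m) ≤ n → suc n < p (suc (suc m)) → a (suc n) ≡ p (suc (suc m)) ∸ suc n
  a-within {n = n} lower n+1<r = cong (_∸ suc n) (nextPrime-constant (m≤n⇒m≤1+n lower) n+1<r)

  p-π-prime : ∀ j → Prime (2 + j) → p (π (2 + j)) ≡ 2 + j
  p-π-prime j pn with bracket j
  ... | record { m = m ; π≡ = π≡ ; lower = lower ; upper = upper } with m≤n⇒m<n∨m≡n lower
  ...   | inj₂ q≡n = trans (cong p π≡) q≡n
  ...   | inj₁ q<n = contradiction pn (noPrimeBelow (nextPrime-least (p (suc m))) (2 + j) q<n upper)

open import Data.Nat using (ℕ; _≤_; suc; _∸_)
open import Data.Nat.Primality using (Prime; Composite)
open import Data.Integer using (ℤ; +_; _+_; _-_; _*_)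
open import Data.Product using (_×_)
open import Relation.Binary.PropositionalEquality using (_≡_)

open PrimeBrackets
  using ( bracket; m; π≡; lower; bracket-step; stay; cross; lowerBound; nextPrime-least
        ; a-within; p-π-prime; S-suc; sumSqGaps-suc )

import Data.Nat as ℕ
import Data.Nat.Properties as ℕ
open import Data.Integer.Properties using (pos-+; pos-*; m-n≡m⊖n; ⊖-≥; *-distribˡ-+)
open import Data.Integer.Tactic.RingSolver using (solve-∀)
open import Data.Product using (_,_)
open import Relation.Binary.PropositionalEquality using (refl; sym; trans; cong; cong₂; module ≡-Reasoning)
open ≡-Reasoning

Ψ : ℤ → ℤ → ℤ → ℤ → ℤ
Ψ n q r T = q * q + + 2 * (+ 1 + n - q) * r + T - n * n - n

Φ : ℕ → ℕ → ℤ
Φ n k = Ψ (+ n) (+ p k) (+ p (suc k)) (+ sumSqGaps (k ∸ 1))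

-- The three identities below are polynomial; the ring solver does not unfold
-- Ψ, so each is handed to it in expanded form.

Ψ-within : ∀ n q r T → Ψ (+ 1 + n) q r T ≡ Ψ n q r T + + 2 * (r - (+ 1 + n))
Ψ-within = expanded
  where
  expanded : ∀ n q r T → q * q + + 2 * (+ 1 + (+ 1 + n) - q) * r + T - (+ 1 + n) * (+ 1 + n) - (+ 1 + n)
                       ≡ q * q + + 2 * (+ 1 + n - q) * r + T - n * n - n + + 2 * (r - (+ 1 + n))
  expanded = solve-∀

Ψ-reach : ∀ n q r r' T → r ≡ + 1 + n → Ψ (+ 1 + n) r r' (T + (r - q) * (r - q)) ≡ Ψ n q r T + + 2 * (r' - r)
Ψ-reach n q _ r' T refl = expanded n q r' T
  where
  expanded : ∀ n q r' T →
    (+ 1 + n) * (+ 1 + n) + + 2 * (+ 1 + (+ 1 + n) - (+ 1 + n)) * r' + (T + (+ 1 + n - q) * (+ 1 + n - q))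
      - (+ 1 + n) * (+ 1 + n) - (+ 1 + n)
    ≡ q * q + + 2 * (+ 1 + n - q) * (+ 1 + n) + T - n * n - n + + 2 * (r' - (+ 1 + n))
  expanded = solve-∀

Ψ-at-prime : ∀ n q r T → q ≡ n → Ψ n q r T ≡ + 2 * r - q + T
Ψ-at-prime n _ r T refl = expanded n r T
  where
  expanded : ∀ n r T → n * n + + 2 * (+ 1 + n - n) * r + T - n * n - n ≡ + 2 * r - n + T
  expanded = solve-∀

pos-∸ : ∀ {x y} → y ≤ x → + (x ∸ y) ≡ + x - + y
pos-∸ {x} {y} y≤x = sym (trans (m-n≡m⊖n x y) (⊖-≥ y≤x))

doubled-S-suc : ∀ n → + 2 * + S (suc n) ≡ + 2 * + S n + + 2 * + a (suc n)
doubled-S-suc n = begin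
  + 2 * + S (suc n)                  ≡⟨ cong (λ s → + 2 * + s) (S-suc n) ⟩
  + 2 * + (S n ℕ.+ a (suc n))        ≡⟨ cong (+ 2 *_) (pos-+ (S n) (a (suc n))) ⟩
  + 2 * (+ S n + + a (suc n))        ≡⟨ *-distribˡ-+ (+ 2) (+ S n) (+ a (suc n)) ⟩
  + 2 * + S n + + 2 * + a (suc n)    ∎

sumSqGaps-suc-ℤ : ∀ m → + sumSqGaps (suc m)
                   ≡ + sumSqGaps m + (+ p (2 ℕ.+ m) - + p (suc m)) * (+ p (2 ℕ.+ m) - + p (suc m))
sumSqGaps-suc-ℤ m = begin
  + sumSqGaps (suc m)                 ≡⟨ cong +_ (sumSqGaps-suc m) ⟩
  + (sumSqGaps m ℕ.+ d (suc m) ℕ.* d (suc m))  ≡⟨ pos-+ (sumSqGaps m) _ ⟩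
  + sumSqGaps m + + (d (suc m) ℕ.* d (suc m))  ≡⟨ cong (_+_ (+ sumSqGaps m)) (pos-* (d (suc m)) (d (suc m))) ⟩
  + sumSqGaps m + + d (suc m) * + d (suc m)    ≡⟨ cong (λ g → + sumSqGaps m + g * g) (pos-∸ q≤r) ⟩
  + sumSqGaps m + (+ p (2 ℕ.+ m) - + p (suc m)) * (+ p (2 ℕ.+ m) - + p (suc m)) ∎
  where
  q≤r : p (suc m) ≤ p (2 ℕ.+ m)
  q≤r = ℕ.<⇒≤ (lowerBound (nextPrime-least (p (suc m))))

S-formula : ∀ j → + 2 * + S (2 ℕ.+ j) ≡ Φ (2 ℕ.+ j) (π (2 ℕ.+ j))
S-formula ℕ.zero    = refl
S-formula (suc j) with bracket j
... | br with bracket-step br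
...   | stay n+1<r π-eq = begin
  + 2 * + S (suc n)                          ≡⟨ doubled-S-suc n ⟩
  + 2 * + S n + + 2 * + a (suc n)            ≡⟨ cong₂ _+_ ih (cong (λ x → + 2 * + x) (a-within {m br} {n} (lower br) n+1<r)) ⟩
  Φ n k + + 2 * + (p (suc k) ∸ suc n)        ≡⟨ cong (λ x → Φ n k + + 2 * x) (pos-∸ {p (suc k)} {suc n} (ℕ.<⇒≤ n+1<r)) ⟩
  Φ n k + + 2 * (+ p (suc k) - + suc n)      ≡⟨ sym (Ψ-within (+ n) (+ p k) (+ p (suc k)) (+ sumSqGaps (m br))) ⟩
  Φ (suc n) k                                ≡⟨ cong (Φ (suc n)) (sym π-eq) ⟩
  Φ (suc n) (π (suc n))                      ∎
  where
  n = 2 ℕ.+ j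
  k = suc (m br)
  ih : + 2 * + S n ≡ Φ n k
  ih = trans (S-formula j) (cong (Φ n) (π≡ br))
...   | cross n+1≡r π-eq = begin
  + 2 * + S (suc n)                          ≡⟨ doubled-S-suc n ⟩
  + 2 * + S n + + 2 * + a (suc n)            ≡⟨ cong₂ _+_ ih (cong (λ x → + 2 * + a x) n+1≡r) ⟩
  Φ n k + + 2 * + (r' ∸ r)                   ≡⟨ cong (λ x → Φ n k + + 2 * x) (pos-∸ {r'} {r} (ℕ.<⇒≤ r<r')) ⟩
  Φ n k + + 2 * (+ r' - + r)                 ≡⟨ sym (Ψ-reach (+ n) (+ q) (+ r) (+ r') (+ sumSqGaps (m br)) (cong +_ (sym n+1≡r))) ⟩
  Ψ (+ suc n) (+ r) (+ r') (+ sumSqGaps (m br) + (+ r - + q) * (+ r - + q))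
                                             ≡⟨ cong (Ψ (+ suc n) (+ r) (+ r')) (sym (sumSqGaps-suc-ℤ (m br))) ⟩
  Φ (suc n) (suc k)                          ≡⟨ cong (Φ (suc n)) (sym π-eq) ⟩
  Φ (suc n) (π (suc n))                      ∎
  where
  n = 2 ℕ.+ j
  k = suc (m br)
  q = p k
  r = p (suc k)
  r' = p (2 ℕ.+ k)
  r<r' : r ℕ.< r'
  r<r' = lowerBound (nextPrime-least r)
  ih : + 2 * + S n ≡ Φ n k
  ih = trans (S-formula j) (cong (Φ n) (π≡ br))

proposition2 :
    ((n : ℕ) → 3 ≤ n → Prime n →
      + 2 * + S n ≡ + 2 * + p (suc (π n)) - + p (π n) + + sumSqGaps (π n ∸ 1))
    ×
    ((n : ℕ) → 4 ≤ n → Composite n →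
      + 2 * + S n ≡ + p (π n) * + p (π n) + + 2 * (+ (suc n) - + p (π n)) * + p (suc (π n))
                    + + sumSqGaps (π n ∸ 1) - + n * + n - + n)
proposition2 = primeCase , compositeCase
  where
  primeCase : (n : ℕ) → 3 ≤ n → Prime n →
    + 2 * + S n ≡ + 2 * + p (suc (π n)) - + p (π n) + + sumSqGaps (π n ∸ 1)
  primeCase n@(suc (suc j)) (ℕ.s≤s (ℕ.s≤s _)) n-prime = begin
    + 2 * + S n  ≡⟨ S-formula j ⟩
    Φ n (π n)    ≡⟨ Ψ-at-prime (+ n) (+ p (π n)) (+ p (suc (π n))) (+ sumSqGaps (π n ∸ 1))
                                (cong +_ (p-π-prime j n-prime)) ⟩
    + 2 * + p (suc (π n)) - + p (π n) + + sumSqGaps (π n ∸ 1) ∎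

  compositeCase : (n : ℕ) → 4 ≤ n → Composite n →
    + 2 * + S n ≡ Φ n (π n)
  compositeCase (suc (suc j)) (ℕ.s≤s (ℕ.s≤s _)) _ = S-formula j
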